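{- Suppose that $F$ is $\zeta$-bounded and preserves monomorphisms. Let $R$ be a relational connector of $F$. If $R$-similarity is sound, then $R$ is normal.
   Context: $F\colon\mathbf{Set}\to\mathbf{Set}$ is a functor. Relations $r\subseteq X\times Y$ are composed applicatively, $r^\circ$ is the converse, functions are regarded as relations, $1_X$ is the identity relation. An $F$-relator $R$ is a monotone assignment of $Rr\subseteq FX\times FY$ to each $r\subseteq X\times Y$; it is normal if $R1_X=1_{FX}$ for all $X$. $R$ is a relational connector if $1_{FX}\le R1_X$ for every set $X$ and $R(g^\circ\cdot r\cdot f)=(Fg)^\circ\cdot Rr\cdot Ff$ for all relations $r\subseteq X\times Y$ and functions $f\colon A\to X$, $g\colon B\to Y$. Given coalgebras $\alpha\colon X\to FX$, $\beta\colon Y\to FY$, $r\subseteq X\times Y$ is an $R$-simulation if $r\le\beta^\circ\cdot Rr\cdot\alpha$; $R$-similarity (the greatest $R$-simulation) is sound if it is always contained in behavioural equivalence (states identified by some pair of coalgebra morphisms into a common coalgebra). $F$ is $\zeta$-bounded if it admits a terminal coalgebra $Z\to FZ$ and for every set $X$ and all $u,v\in FX$ there are a set $A$ with $|A|\le|Z|$ and an injective map $i\colon A\to X$ with $u,v$ in the image of $Fi$. -}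

module Defs where

open import Level using (Level; _⊔_) renaming (suc to lsuc; zero to lzero)
open import Data.Product using (Σ; ∃; _×_; _,_; proj₁; proj₂)
open import Relation.Binary.PropositionalEquality using (_≡_)
open import Function using (_∘_; id)
open import Function.Definitions using (Injective)

Rel : Set → Set → Set₁
Rel X Y = X → Y → Set

_⊆_ : {X Y : Set} → Rel X Y → Rel X Y → Set
r ⊆ s = ∀ {x y} → r x y → s x y

_≐_ : {X Y : Set} → Rel X Y → Rel X Y → Set
r ≐ s = (r ⊆ s) × (s ⊆ r)

1R : (X : Set) → Rel X X
1R X = _≡_

-- g° · r · f for functions f : A → X, g : B → Y
conj : {A B X Y : Set} → (g : B → Y) → Rel X Y → (f : A → X) → Rel A B
conj g r f a b = r (f a) (g b)

Inj : {A B : Set} → (A → B) → Set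
Inj f = Injective _≡_ _≡_ f

record Functor : Set₁ where
  field
    F₀     : Set → Set
    fmap   : {X Y : Set} → (X → Y) → F₀ X → F₀ Y
    fmap-ext : {X Y : Set} {f g : X → Y} → (∀ x → f x ≡ g x) → ∀ u → fmap f u ≡ fmap g u
    fmap-id  : {X : Set} (u : F₀ X) → fmap id u ≡ u
    fmap-∘   : {X Y W : Set} (f : X → Y) (g : Y → W) (u : F₀ X) →
               fmap (g ∘ f) u ≡ fmap g (fmap f u)

module _ (Fn : Functor) where
  open Functor Fn

  PreservesMonos : Set₁
  PreservesMonos = {X Y : Set} (f : X → Y) → Inj f → Inj (fmap f)

  record Coalg : Set₁ where
    constructor coalg
    field
      Carrier : Set
      str     : Carrier → F₀ Carrier
  open Coalg public

  IsCoalgMor : (C D : Coalg) → (Carrier C → Carrier D) → Set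
  IsCoalgMor C D h = ∀ x → str D (h x) ≡ fmap h (str C x)

  IsTerminal : Coalg → Set₁
  IsTerminal T = (C : Coalg) →
    Σ (Carrier C → Carrier T) λ h → IsCoalgMor C T h ×
      ((k : Carrier C → Carrier T) → IsCoalgMor C T k → ∀ x → k x ≡ h x)

  -- |A| ≤ |Z|
  _≼_ : Set → Set → Set
  A ≼ Z = Σ (A → Z) Inj

  ZetaBounded : Set₁
  ZetaBounded = Σ Coalg λ T → IsTerminal T ×
    ((X : Set) (u v : F₀ X) →
      Σ Set λ A → (A ≼ Carrier T) × Σ (A → X) λ i → Inj i ×
        (Σ (F₀ A) λ a → fmap i a ≡ u) × (Σ (F₀ A) λ b → fmap i b ≡ v))

  record Relator : Set₁ where
    field
      act  : {X Y : Set} → Rel X Y → Rel (F₀ X) (F₀ Y)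
      mono : {X Y : Set} {r s : Rel X Y} → r ⊆ s → act r ⊆ act s
  open Relator public

  Normal : Relator → Set₁
  Normal R = (X : Set) → act R (1R X) ≐ 1R (F₀ X)

  IsRelationalConnector : Relator → Set₁
  IsRelationalConnector R =
    ((X : Set) → 1R (F₀ X) ⊆ act R (1R X)) ×
    ({X Y A B : Set} (r : Rel X Y) (f : A → X) (g : B → Y) →
       act R (conj g r f) ≐ conj (fmap g) (act R r) (fmap f))

  -- r is an R-simulation between α and β: r ≤ β° · R r · α
  IsSimulation : Relator → (C D : Coalg) → Rel (Carrier C) (Carrier D) → Set
  IsSimulation R C D r = ∀ {x y} → r x y → act R r (str C x) (str D y)

  -- R-similarity (the greatest R-simulation = union of all R-simulations)
  Similarity : (R : Relator) (C D : Coalg) → Carrier C → Carrier D → Set₁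
  Similarity R C D x y = Σ (Rel (Carrier C) (Carrier D)) λ r → IsSimulation R C D r × r x y

  BehEq : (C D : Coalg) → Carrier C → Carrier D → Set₁
  BehEq C D x y = Σ Coalg λ E → Σ (Carrier C → Carrier E) λ f → Σ (Carrier D → Carrier E) λ g →
    IsCoalgMor C E f × IsCoalgMor D E g × (f x ≡ g y)

  SimilaritySound : Relator → Set₁
  SimilaritySound R = (C D : Coalg) (x : Carrier C) (y : Carrier D) →
    Similarity R C D x y → BehEq C D x y

-- For c, d ∈ FZ adjoin to the terminal coalgebra Z a fresh state whose successor is c
-- (resp. d). If c R1_Z d, the diagonal is an R-simulation between the two extended
-- coalgebras relating the fresh states, so by soundness they are behaviourally
-- equivalent; mapping to Z, both land on the same point z with ζ z = c and ζ z = d.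
-- Hence R1_Z ⊆ 1. A general pair u R1_X v lives in the image of Fi for some injection
-- i : A → X with A ↪ Z; the connector laws move the relatedness to FA and then to FZ,
-- where it becomes equality, which F (preserving monos) reflects back.
module Submission where

open import Defs
open import Data.Product using (_,_; proj₁; proj₂)
open import Data.Maybe using (Maybe; just; nothing)
open import Relation.Binary.PropositionalEquality using (_≡_; refl; sym; trans; cong)
open import Function using (_∘_; id)

module _ {Fn : Functor} where
  open Functor Fn

  ∘-isCoalgMor : (C D E : Coalg Fn) {f : Carrier C → Carrier D} {g : Carrier D → Carrier E} →
    IsCoalgMor Fn C D f → IsCoalgMor Fn D E g → IsCoalgMor Fn C E (g ∘ f)
  ∘-isCoalgMor C D E {f} {g} f-mor g-mor x =
    trans (g-mor (f x)) (trans (cong (fmap g) (f-mor x)) (sym (fmap-∘ f g (str C x))))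

  terminal-endo≗id : (T : Coalg Fn) → IsTerminal Fn T →
    (k : Carrier T → Carrier T) → IsCoalgMor Fn T T k → ∀ z → k z ≡ z
  terminal-endo≗id T term k k-mor z =
    trans (unique k k-mor z) (sym (unique id (λ x → sym (fmap-id (str T x))) z))
    where unique = proj₂ (proj₂ (term T))

  -- nothing is the fresh state, with successor c.
  adjoin : (C : Coalg Fn) → F₀ (Carrier C) → Coalg Fn
  adjoin C c = coalg (Maybe (Carrier C)) step
    where
      step : Maybe (Carrier C) → F₀ (Maybe (Carrier C))
      step nothing  = fmap just c
      step (just x) = fmap just (str C x)

  just-isCoalgMor : (C : Coalg Fn) (c : F₀ (Carrier C)) → IsCoalgMor Fn C (adjoin C c) just
  just-isCoalgMor C c x = refl

  module _ (T : Coalg Fn) (term : IsTerminal Fn T) where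

    str-unfold-adjoin : (c : F₀ (Carrier T)) (E : Coalg Fn) (f : Maybe (Carrier T) → Carrier E) →
      IsCoalgMor Fn (adjoin T c) E f → str T (proj₁ (term E) (f nothing)) ≡ c
    str-unfold-adjoin c E f f-mor =
      trans (h∘f-mor nothing)
        (trans (sym (fmap-∘ just (h ∘ f) c))
          (trans (fmap-ext (terminal-endo≗id T term (h ∘ f ∘ just) h∘f∘just-mor) c)
            (fmap-id c)))
      where
        h = proj₁ (term E)
        h∘f-mor : IsCoalgMor Fn (adjoin T c) T (h ∘ f)
        h∘f-mor = ∘-isCoalgMor (adjoin T c) E T f-mor (proj₁ (proj₂ (term E)))
        h∘f∘just-mor : IsCoalgMor Fn T T (h ∘ f ∘ just)
        h∘f∘just-mor = ∘-isCoalgMor T (adjoin T c) T (just-isCoalgMor T c) h∘f-mor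

    adjoin-behEq⇒≡ : (c d : F₀ (Carrier T)) →
      BehEq Fn (adjoin T c) (adjoin T d) nothing nothing → c ≡ d
    adjoin-behEq⇒≡ c d (E , f , g , f-mor , g-mor , f≡g) =
      trans (sym (str-unfold-adjoin c E f f-mor))
        (trans (cong (str T ∘ proj₁ (term E)) f≡g) (str-unfold-adjoin d E g g-mor))

  module _ (R : Relator Fn) (conn : IsRelationalConnector Fn R) where

    private
      naturality = proj₂ conn

    R1-fmap : {X Y : Set} (f : X → Y) {u v : F₀ X} →
      act R (1R X) u v → act R (1R Y) (fmap f u) (fmap f v)
    R1-fmap {Y = Y} f = proj₁ (naturality (1R Y) f f) ∘ mono R (cong f)

    R1-reflect-inj : {A X : Set} (i : A → X) → Inj i → {a b : F₀ A} →
      act R (1R X) (fmap i a) (fmap i b) → act R (1R A) a b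
    R1-reflect-inj {X = X} i i-inj = mono R i-inj ∘ proj₂ (naturality (1R X) i i)

    ≡-isSimulation-adjoin : (C : Coalg Fn) {c d : F₀ (Carrier C)} → act R (1R (Carrier C)) c d →
      IsSimulation Fn R (adjoin C c) (adjoin C d) _≡_
    ≡-isSimulation-adjoin C Rcd {nothing} refl = R1-fmap just Rcd
    ≡-isSimulation-adjoin C Rcd {just x}  refl = proj₁ conn (Maybe (Carrier C)) refl

    R1-terminal⊆≡ : SimilaritySound Fn R → (T : Coalg Fn) → IsTerminal Fn T →
      act R (1R (Carrier T)) ⊆ 1R (F₀ (Carrier T))
    R1-terminal⊆≡ sound T term {c} {d} Rcd =
      adjoin-behEq⇒≡ T term c d
        (sound (adjoin T c) (adjoin T d) nothing nothing
          (_≡_ , ≡-isSimulation-adjoin T Rcd , refl))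

theorem15 : (Fn : Functor) → ZetaBounded Fn → PreservesMonos Fn →
    (R : Relator Fn) → IsRelationalConnector Fn R →
    SimilaritySound Fn R → Normal Fn R
theorem15 Fn (T , term , bounded) preserves R conn sound X = R1⊆≡ , proj₁ conn X
  where
    open Functor Fn
    R1⊆≡ : act R (1R X) ⊆ 1R (F₀ X)
    R1⊆≡ {u} {v} Ruv with bounded X u v
    ... | A , (j , j-inj) , i , i-inj , (a , refl) , (b , refl) =
      cong (fmap i) (preserves j j-inj
        (R1-terminal⊆≡ R conn sound T term (R1-fmap R conn j (R1-reflect-inj R conn i i-inj Ruv))))
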